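{- Let $n\ge2$ be an integer. There is an injective map from $A$ to $B_1$, where $A$ is the set of ordered pairs $(\gamma,\delta)$ of $(n-1)$-cycles on $\{0,1,\dots,n-2\}$ with $\gamma\circ\delta=X_{n-2}$, and $B_1$ is the set of ordered pairs $(\gamma_1,\delta_1)$ of $(n+1)$-cycles on $\{0,1,\dots,n\}$ with $\gamma_1\circ\delta_1=X_n$ and $\delta_1$ of the form $(0\;n\;1\;\cdots)$ (i.e. $\delta_1(0)=n$ and $\delta_1(n)=1$).
   Context: For $m\ge0$, $X_m$ denotes the cycle $(0\;1\;2\;\cdots\;m)$ on $\{0,\dots,m\}$. Cycle notation $(c_1\cdots c_k)$ sends $c_1\mapsto c_2\mapsto\cdots\mapsto c_k\mapsto c_1$; composition is right-to-left, $(f\circ g)(x)=f(g(x))$. -}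

module Defs where

open import Data.Nat using (ℕ; zero; suc; _<_)
open import Data.Nat.Properties using (_≟_)
open import Data.Fin using (Fin; toℕ; lower₁)
open import Data.Fin.Permutation using (Permutation′; _⟨$⟩ʳ_)
open import Data.Product using (Σ; ∃; _×_; _,_)
open import Function using (_∘_)
open import Relation.Binary.PropositionalEquality using (_≡_)
open import Relation.Nullary using (yes; no)

-- the standard cycle X_m = (0 1 2 ... m) on {0,...,m} = Fin (suc m):
-- i ↦ i + 1 for i < m, and m ↦ 0.
X : (m : ℕ) → Fin (suc m) → Fin (suc m)
X m i with m ≟ toℕ i
... | yes _ = Fin.zero
... | no m≢i = Fin.suc (lower₁ i m≢i)

iter : ∀ {A : Set} → (A → A) → ℕ → A → A
iter f zero x = x
iter f (suc k) x = f (iter f k x)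

-- σ is an N-cycle on Fin N (a single cycle through all N points):
-- every point lies in the orbit of every point
-- (equivalently: of one point; we use the symmetric form).
IsFullCycle : ∀ {N} → Permutation′ N → Set
IsFullCycle {N} σ = ∀ (x y : Fin N) → ∃ λ k → iter (σ ⟨$⟩ʳ_) k x ≡ y

_≐_ : ∀ {N} → Permutation′ N → Permutation′ N → Set
_≐_ {N} σ τ = ∀ (x : Fin N) → σ ⟨$⟩ʳ x ≡ τ ⟨$⟩ʳ x

record CyclePair (m : ℕ) : Set where
  constructor cyclePair
  field
    γ : Permutation′ (suc m)
    δ : Permutation′ (suc m)
    γ-cycle : IsFullCycle γ
    δ-cycle : IsFullCycle δ
    factor : ∀ (x : Fin (suc m)) → γ ⟨$⟩ʳ (δ ⟨$⟩ʳ x) ≡ X m x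

_≈CP_ : ∀ {m} → CyclePair m → CyclePair m → Set
p ≈CP q = (CyclePair.γ p ≐ CyclePair.γ q) × (CyclePair.δ p ≐ CyclePair.δ q)

-- The set A (with n = k + 2): pairs of (n-1)-cycles on {0,...,n-2} with γ∘δ = X_{n-2}
SetA : ℕ → Set
SetA k = CyclePair k

SetB₁ : ℕ → Set
SetB₁ k = Σ (CyclePair (suc (suc k))) λ p →
  (CyclePair.δ p ⟨$⟩ʳ Fin.zero ≡ Data.Fin.fromℕ (suc (suc k)))
  × (CyclePair.δ p ⟨$⟩ʳ Data.Fin.fromℕ (suc (suc k)) ≡ Fin.suc Fin.zero)

_≈B_ : ∀ {k} → SetB₁ k → SetB₁ k → Set
(p , _) ≈B (q , _) = p ≈CP q

-- Shift {0,…,n-2} to {1,…,n-1}, let ê σ extend a map σ by fixing the new points 0 and n,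
-- and let ρ be the 3-cycle (0 n 1). Send (γ, δ) to δ₁ = ρ ∘ ê δ and
-- γ₁ = ρ ∘ (ρ ∘ ê γ) ∘ ρ⁻¹. As ρ⁻¹ = ρ² and ρ² ∘ ê X_{n-2} = X_n, we get
-- γ₁ ∘ δ₁ = ρ² ∘ ê (γ ∘ δ) = X_n. The map ρ ∘ ê σ follows the cycle of σ but passes through
-- 0 and n just before reaching 1, so it is again a full cycle, and so is its conjugate γ₁.
-- Finally δ₁ determines δ, and in a factorisation of X the right factor determines the left.
module Submission where

open import Defs
open import Data.Nat using (ℕ; zero; suc; _+_)
open import Data.Nat.Properties using (_≟_)
open import Data.Fin using (Fin; toℕ; fromℕ; inject₁)
open import Data.Fin.Properties
  using (toℕ-fromℕ; toℕ-inject₁-≢; lower₁-inject₁′; inject₁-injective; suc-injective)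
open import Data.Fin.Relation.Unary.Top using (view; ‵fromℕ; ‵inj₁; view-fromℕ; view-inject₁)
open import Data.Fin.Permutation
  using (Permutation′; _⟨$⟩ʳ_; _⟨$⟩ˡ_; permutation; inverseʳ; inverseˡ; flip; _∘ₚ_)
open import Data.Product using (Σ; ∃; _,_)
open import Function using (_∘_)
open import Relation.Binary.PropositionalEquality
open import Relation.Nullary using (yes; no; contradiction)

X-fromℕ : ∀ m → X m (fromℕ m) ≡ Fin.zero
X-fromℕ m with m ≟ toℕ (fromℕ m)
... | yes _ = refl
... | no m≢m = contradiction (sym (toℕ-fromℕ m)) m≢m

X-inject₁ : ∀ {m} (i : Fin m) → X m (inject₁ i) ≡ Fin.suc i
X-inject₁ {m} i with m ≟ toℕ (inject₁ i)
... | yes m≡i = contradiction m≡i (toℕ-inject₁-≢ i)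
... | no m≢i = cong Fin.suc (lower₁-inject₁′ i m≢i)

module _ {A : Set} (f : A → A) where

  Reach : A → A → Set
  Reach x y = ∃ λ k → iter f k x ≡ y

  SingleOrbit : Set
  SingleOrbit = ∀ x y → Reach x y

  iter-+ : ∀ k l x → iter f (k + l) x ≡ iter f k (iter f l x)
  iter-+ zero l x = refl
  iter-+ (suc k) l x = cong f (iter-+ k l x)

  reach-refl : ∀ {x} → Reach x x
  reach-refl = 0 , refl

  reach-step : ∀ {x y} → f x ≡ y → Reach x y
  reach-step fx≡y = 1 , fx≡y

  reach-trans : ∀ {x y z} → Reach x y → Reach y z → Reach x z
  reach-trans {x} (k , fᵏx≡y) (l , fˡy≡z) =
    l + k , trans (iter-+ l k x) (trans (cong (iter f l) fᵏx≡y) fˡy≡z)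

  singleOrbit⇒surjective : SingleOrbit → ∀ y → ∃ λ x → f x ≡ y
  singleOrbit⇒surjective orbit y with orbit (f y) y
  ... | zero , fy≡y = y , fy≡y
  ... | suc k , fᵏ⁺¹fy≡y = iter f k (f y) , fᵏ⁺¹fy≡y

reach-map : ∀ {A B : Set} {f : A → A} {g : B → B} (e : A → B) →
            (∀ x → Reach g (e x) (e (f x))) →
            ∀ {x y} → Reach f x y → Reach g (e x) (e y)
reach-map {f = f} {g} e step {x} (k , fᵏx≡y) = subst (Reach g (e x) ∘ e) fᵏx≡y (go k)
  where
  go : ∀ k → Reach g (e x) (e (iter f k x))
  go zero = reach-refl g
  go (suc k) = reach-trans g (go k) (step (iter f k x))

singleOrbit-conj : ∀ {n} (π u : Permutation′ n) → SingleOrbit (π ⟨$⟩ʳ_) →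
                   SingleOrbit ((flip u ∘ₚ π ∘ₚ u) ⟨$⟩ʳ_)
singleOrbit-conj π u orbit y z =
  subst₂ (Reach _) (inverseʳ u) (inverseʳ u) (reach-map (u ⟨$⟩ʳ_) step (orbit _ _))
  where
  step : ∀ x → Reach ((flip u ∘ₚ π ∘ₚ u) ⟨$⟩ʳ_) (u ⟨$⟩ʳ x) (u ⟨$⟩ʳ (π ⟨$⟩ʳ x))
  step x = reach-step _ (cong (λ w → u ⟨$⟩ʳ (π ⟨$⟩ʳ w)) (inverseˡ u))

module Extension {m : ℕ} where

  embed : Fin (suc m) → Fin (3 + m)
  embed j = Fin.suc (inject₁ j)

  top : Fin (3 + m)
  top = fromℕ (2 + m)

  data Split : Fin (3 + m) → Set where
    at-zero : Split Fin.zero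
    at-embed : ∀ j → Split (embed j)
    at-top : Split top

  split : ∀ x → Split x
  split Fin.zero = at-zero
  split (Fin.suc i) with view i
  ... | ‵fromℕ = at-top
  ... | ‵inj₁ {i = j} _ = at-embed j

  split-embed : ∀ j → split (embed j) ≡ at-embed j
  split-embed j rewrite view-inject₁ j = refl

  split-top : split top ≡ at-top
  split-top rewrite view-fromℕ (suc m) = refl

  embed-injective : ∀ {i j} → embed i ≡ embed j → i ≡ j
  embed-injective = inject₁-injective ∘ suc-injective

  extendAt : (Fin (suc m) → Fin (suc m)) → ∀ {x} → Split x → Fin (3 + m)
  extendAt f at-zero = Fin.zero
  extendAt f (at-embed j) = embed (f j)
  extendAt f at-top = top

  extend : (Fin (suc m) → Fin (suc m)) → Fin (3 + m) → Fin (3 + m)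
  extend f x = extendAt f (split x)

  extend-embed : ∀ f j → extend f (embed j) ≡ embed (f j)
  extend-embed f j = cong (extendAt f) (split-embed j)

  extend-top : ∀ f → extend f top ≡ top
  extend-top f = cong (extendAt f) split-top

  extend-∘ : ∀ {f g h} → (∀ j → f (g j) ≡ h j) →
             ∀ x → extend f (extend g x) ≡ extend h x
  extend-∘ {f} {g} {h} f∘g≗h x with split x
  ... | at-zero = refl
  ... | at-embed j = trans (extend-embed f (g j)) (cong embed (f∘g≗h j))
  ... | at-top = extend-top f

  extend-id : ∀ x → extend (λ j → j) x ≡ x
  extend-id x with split x
  ... | at-zero = refl
  ... | at-embed j = refl
  ... | at-top = refl

  ρAt : ∀ {x} → Split x → Fin (3 + m)
  ρAt at-zero = top
  ρAt at-top = embed Fin.zero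
  ρAt (at-embed Fin.zero) = Fin.zero
  ρAt (at-embed (Fin.suc j)) = embed (Fin.suc j)

  ρ : Fin (3 + m) → Fin (3 + m)
  ρ x = ρAt (split x)

  ρ-top : ρ top ≡ embed Fin.zero
  ρ-top = cong ρAt split-top

  ρ-embed-zero : ρ (embed Fin.zero) ≡ Fin.zero
  ρ-embed-zero = cong ρAt (split-embed Fin.zero)

  ρ-embed-suc : ∀ j → ρ (embed (Fin.suc j)) ≡ embed (Fin.suc j)
  ρ-embed-suc j = cong ρAt (split-embed (Fin.suc j))

  ρ³ : ∀ x → ρ (ρ (ρ x)) ≡ x
  ρ³ x with split x
  ... | at-zero = trans (cong ρ ρ-top) ρ-embed-zero
  ... | at-top = cong ρ ρ-embed-zero
  ... | at-embed Fin.zero = ρ-top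
  ... | at-embed (Fin.suc j) = trans (cong ρ (ρ-embed-suc j)) (ρ-embed-suc j)

  ρ²∘extend-X : ∀ x → ρ (ρ (extend (X m) x)) ≡ X (2 + m) x
  ρ²∘extend-X x with split x
  ... | at-zero = trans ρ-top (sym (X-inject₁ Fin.zero))
  ... | at-top = trans (cong ρ ρ-top) (trans ρ-embed-zero (sym (X-fromℕ (2 + m))))
  ... | at-embed j = trans (ρ²-embed-X j) (sym (X-inject₁ (Fin.suc j)))
    where
    ρ²-embed-X : ∀ j → ρ (ρ (embed (X m j))) ≡ Fin.suc (Fin.suc j)
    ρ²-embed-X j with view j
    ... | ‵fromℕ rewrite X-fromℕ m = cong ρ ρ-embed-zero
    ... | ‵inj₁ {i = i} _ rewrite X-inject₁ i =
      trans (cong ρ (ρ-embed-suc i)) (ρ-embed-suc i)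

  module _ {f : Fin (suc m) → Fin (suc m)} (orbit : SingleOrbit f) where

    private
      g : Fin (3 + m) → Fin (3 + m)
      g = ρ ∘ extend f

      zero↝top : Reach g Fin.zero top
      zero↝top = reach-step g refl

      top↝embed-zero : Reach g top (embed Fin.zero)
      top↝embed-zero = reach-step g (trans (cong ρ (extend-top f)) ρ-top)

      ρ-embed↝embed : ∀ j → Reach g (ρ (embed j)) (embed j)
      ρ-embed↝embed Fin.zero =
        subst (λ x → Reach g x (embed Fin.zero)) (sym ρ-embed-zero)
              (reach-trans g zero↝top top↝embed-zero)
      ρ-embed↝embed (Fin.suc j) =
        subst (λ x → Reach g x (embed (Fin.suc j))) (sym (ρ-embed-suc j)) (reach-refl g)

      embed↝embed : ∀ i j → Reach g (embed i) (embed j)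
      embed↝embed i j = reach-map embed step (orbit i j)
        where
        step : ∀ j → Reach g (embed j) (embed (f j))
        step j = reach-trans g (reach-step g (cong ρ (extend-embed f j)))
                               (ρ-embed↝embed (f j))

      ↝embed-zero : ∀ {x} → Split x → Reach g x (embed Fin.zero)
      ↝embed-zero at-zero = reach-trans g zero↝top top↝embed-zero
      ↝embed-zero at-top = top↝embed-zero
      ↝embed-zero (at-embed j) = embed↝embed j Fin.zero

      embed-zero↝ : ∀ {x} → Split x → Reach g (embed Fin.zero) x
      embed-zero↝ at-zero with singleOrbit⇒surjective f orbit Fin.zero
      ... | j , fj≡0 = reach-trans g (embed↝embed Fin.zero j) (reach-step g g-embed-j≡0)
        where
        g-embed-j≡0 : g (embed j) ≡ Fin.zero
        g-embed-j≡0 = trans (cong ρ (trans (extend-embed f j) (cong embed fj≡0))) ρ-embed-zero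
      embed-zero↝ at-top = reach-trans g (embed-zero↝ at-zero) zero↝top
      embed-zero↝ (at-embed j) = embed↝embed Fin.zero j

    ρ∘extend-singleOrbit : SingleOrbit (ρ ∘ extend f)
    ρ∘extend-singleOrbit x y = reach-trans g (↝embed-zero (split x)) (embed-zero↝ (split y))

  ρ-injective : ∀ {x y} → ρ x ≡ ρ y → x ≡ y
  ρ-injective {x} {y} ρx≡ρy = trans (sym (ρ³ x)) (trans (cong (ρ ∘ ρ) ρx≡ρy) (ρ³ y))

  ρₚ : Permutation′ (3 + m)
  ρₚ = permutation ρ (ρ ∘ ρ) ρ³ ρ³

  extendₚ : Permutation′ (suc m) → Permutation′ (3 + m)
  extendₚ σ = permutation (extend (σ ⟨$⟩ʳ_)) (extend (σ ⟨$⟩ˡ_))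
    (λ x → trans (extend-∘ (λ _ → inverseʳ σ) x) (extend-id x))
    (λ x → trans (extend-∘ (λ _ → inverseˡ σ) x) (extend-id x))

open Extension

factor-determines-γ : ∀ {m} (p q : CyclePair m) →
                      CyclePair.δ p ≐ CyclePair.δ q → CyclePair.γ p ≐ CyclePair.γ q
factor-determines-γ {m} p q δ≐δ′ y = begin
  γ p ⟨$⟩ʳ y                      ≡⟨ cong (γ p ⟨$⟩ʳ_) (sym (inverseʳ (δ p))) ⟩
  γ p ⟨$⟩ʳ (δ p ⟨$⟩ʳ x)           ≡⟨ factor p x ⟩
  X _ x                           ≡⟨ sym (factor q x) ⟩
  γ q ⟨$⟩ʳ (δ q ⟨$⟩ʳ x)           ≡⟨ cong (γ q ⟨$⟩ʳ_) (sym (δ≐δ′ x)) ⟩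
  γ q ⟨$⟩ʳ (δ p ⟨$⟩ʳ x)           ≡⟨ cong (γ q ⟨$⟩ʳ_) (inverseʳ (δ p)) ⟩
  γ q ⟨$⟩ʳ y                      ∎
  where
  open CyclePair
  open ≡-Reasoning
  x : Fin (suc m)
  x = δ p ⟨$⟩ˡ y

module _ {m : ℕ} (p : CyclePair m) where
  open CyclePair p

  δ₁ : Permutation′ (3 + m)
  δ₁ = extendₚ δ ∘ₚ ρₚ

  -- _∘ₚ_ composes diagrammatically, so this is ρ ∘ (ρ ∘ ê γ) ∘ ρ⁻¹.
  γ₁ : Permutation′ (3 + m)
  γ₁ = flip ρₚ ∘ₚ (extendₚ γ ∘ₚ ρₚ) ∘ₚ ρₚ

  γ₁∘δ₁≗X : ∀ x → γ₁ ⟨$⟩ʳ (δ₁ ⟨$⟩ʳ x) ≡ X (2 + m) x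
  γ₁∘δ₁≗X x = begin
    ρ (ρ (extend (γ ⟨$⟩ʳ_) (ρ (ρ (ρ (extend (δ ⟨$⟩ʳ_) x))))))
      ≡⟨ cong (ρ ∘ ρ ∘ extend (γ ⟨$⟩ʳ_)) (ρ³ (extend (δ ⟨$⟩ʳ_) x)) ⟩
    ρ (ρ (extend (γ ⟨$⟩ʳ_) (extend (δ ⟨$⟩ʳ_) x)))
      ≡⟨ cong (ρ ∘ ρ) (extend-∘ factor x) ⟩
    ρ (ρ (extend (X m) x))
      ≡⟨ ρ²∘extend-X x ⟩
    X (2 + m) x ∎
    where open ≡-Reasoning

  extendPair : SetB₁ m
  extendPair = cyclePair γ₁ δ₁ γ₁-cycle δ₁-cycle γ₁∘δ₁≗X
             , refl
             , trans (cong ρ (extend-top (δ ⟨$⟩ʳ_))) ρ-top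
    where
    δ₁-cycle : IsFullCycle δ₁
    δ₁-cycle = ρ∘extend-singleOrbit δ-cycle
    γ₁-cycle : IsFullCycle γ₁
    γ₁-cycle = singleOrbit-conj (extendₚ γ ∘ₚ ρₚ) ρₚ (ρ∘extend-singleOrbit γ-cycle)

extendPair-injective : ∀ {m} (p q : CyclePair m) → extendPair p ≈B extendPair q → p ≈CP q
extendPair-injective p q (_ , δ₁≐δ₁′) = factor-determines-γ p q δ≐δ′ , δ≐δ′
  where
  open CyclePair
  δ≐δ′ : δ p ≐ δ q
  δ≐δ′ j = embed-injective (ρ-injective (begin
    ρ (embed (δ p ⟨$⟩ʳ j))         ≡⟨ cong ρ (extend-embed _ j) ⟨
    δ₁ p ⟨$⟩ʳ embed j              ≡⟨ δ₁≐δ₁′ (embed j) ⟩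
    δ₁ q ⟨$⟩ʳ embed j              ≡⟨ cong ρ (extend-embed _ j) ⟩
    ρ (embed (δ q ⟨$⟩ʳ j))         ∎))
    where open ≡-Reasoning

lemma3p6 : (k : ℕ) → Σ (SetA k → SetB₁ k) λ f →
    ∀ (a a′ : SetA k) → f a ≈B f a′ → a ≈CP a′
lemma3p6 k = extendPair , extendPair-injective
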